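{- For all conditional formulas $\phi,\psi$: (1) $\phi\mathbin{\Box\!\!\to}\psi\in\mathsf{CnCK}_R$ if and only if $\phi\to\psi\in\mathsf{CnCK}_R$; (2) $\phi\mathbin{\Diamond\!\!\to}\psi\notin\mathsf{CnCK}_R$.
   Context: Conditional formulas are built from propositional letters with $\wedge,\vee,\to$, $\sim$ (strong negation), binary $\mathbin{\Box\!\!\to}$, $\mathbin{\Diamond\!\!\to}$. A conditional Fischer-Servi model is $(W,\leq,R,V^+,V^-)$, $W\neq\emptyset$, $\leq$ a preorder, $R\subseteq W\times(\mathcal{P}(W))^2\times W$, $V^\pm$ maps letters to $\leq$-upward closed sets, such that for all $X,Y$, $R_{(X,Y)}=\{(w,v)\mid R(w,(X,Y),v)\}$ satisfies (c1) $w\leq w'$, $wR_{(X,Y)}v$ imply $w'R_{(X,Y)}v'$, $v\leq v'$ for some $v'$; (c2) $wR_{(X,Y)}v$, $v\leq v'$ imply $w\leq w'$, $w'R_{(X,Y)}v'$ for some $w'$. It is reflexive if $R(w,(X,Y),v)$ implies $v\in X$. Satisfaction: $w\models^\pm p$ iff $w\in V^\pm(p)$; $\wedge$: $+$ iff both $+$, $-$ iff some $-$; $\vee$: $+$ iff some $+$, $-$ iff both $-$; $w\models^\pm\sim\psi$ iff $w\models^\mp\psi$; $w\models^+\psi\to\chi$ iff $\forall v\geq w(v\models^+\psi\Rightarrow v\models^+\chi)$; $w\models^-\psi\to\chi$ iff $\forall v\geq w(v\models^+\psi\Rightarrow v\models^-\chi)$; with $\|\psi\|=(\{w\mid w\models^+\psi\},\{w\mid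 w\models^-\psi\})$: $w\models^\pm\psi\mathbin{\Box\!\!\to}\chi$ iff $\forall v\geq w\,\forall u(vR_{\|\psi\|}u\Rightarrow u\models^\pm\chi)$; $w\models^\pm\psi\mathbin{\Diamond\!\!\to}\chi$ iff $\exists u(wR_{\|\psi\|}u$ and $u\models^\pm\chi)$. $\phi\in\mathsf{CnCK}_R$ iff $\phi$ is verified ($\models^+$) at every world of every reflexive conditional Fischer-Servi model. -}

module Defs where

open import Data.Nat using (ℕ)
open import Data.Product using (Σ; _×_; _,_; ∃)
open import Data.Sum using (_⊎_)
open import Relation.Nullary using (¬_)

Atom : Set
Atom = ℕ

infixr 6 _∧_
infixr 5 _∨_
infixr 4 _⇒_ _□→_ _◇→_

data Fm : Set where
  var  : Atom → Fm
  _∧_  : Fm → Fm → Fm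
  _∨_  : Fm → Fm → Fm
  _⇒_  : Fm → Fm → Fm
  ∼_   : Fm → Fm
  _□→_ : Fm → Fm → Fm
  _◇→_ : Fm → Fm → Fm

-- Subsets of W are predicates W → Set; the relation R is required to be
-- extensional in the set arguments (so it really is a relation on P(W)).
_⇔ₚ_ : {W : Set} → (W → Set) → (W → Set) → Set
X ⇔ₚ X' = ∀ w → (X w → X' w) × (X' w → X w)

record CFSModel : Set₁ where
  field
    W      : Set
    w₀     : W
    _≤_    : W → W → Set
    ≤-refl : ∀ {w} → w ≤ w
    ≤-trans : ∀ {u v w} → u ≤ v → v ≤ w → u ≤ w
    R      : W → (W → Set) → (W → Set) → W → Set
    R-ext  : ∀ {X X' Y Y' w v} → X ⇔ₚ X' → Y ⇔ₚ Y' → R w X Y v → R w X' Y' v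
    V⁺     : Atom → W → Set
    V⁻     : Atom → W → Set
    V⁺-up  : ∀ p {w w'} → w ≤ w' → V⁺ p w → V⁺ p w'
    V⁻-up  : ∀ p {w w'} → w ≤ w' → V⁻ p w → V⁻ p w'
    c1     : ∀ X Y {w w' v} → w ≤ w' → R w X Y v → Σ W (λ v' → R w' X Y v' × v ≤ v')
    c2     : ∀ X Y {w v v'} → R w X Y v → v ≤ v' → Σ W (λ w' → w ≤ w' × R w' X Y v')

Reflexive : CFSModel → Set₁
Reflexive M = ∀ {w} X Y {v} → R w X Y v → X v
  where open CFSModel M

data Sign : Set where
  pos neg : Sign

flipS : Sign → Sign
flipS pos = neg
flipS neg = pos

module _ (M : CFSModel) where
  open CFSModel M

  -- sat pos w φ  is  w ⊨⁺ φ ;  sat neg w φ  is  w ⊨⁻ φ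
  sat : Sign → W → Fm → Set
  sat pos w (var p) = V⁺ p w
  sat neg w (var p) = V⁻ p w
  sat pos w (φ ∧ ψ) = sat pos w φ × sat pos w ψ
  sat neg w (φ ∧ ψ) = sat neg w φ ⊎ sat neg w ψ
  sat pos w (φ ∨ ψ) = sat pos w φ ⊎ sat pos w ψ
  sat neg w (φ ∨ ψ) = sat neg w φ × sat neg w ψ
  sat pos w (φ ⇒ ψ) = ∀ v → w ≤ v → sat pos v φ → sat pos v ψ
  sat neg w (φ ⇒ ψ) = ∀ v → w ≤ v → sat pos v φ → sat neg v ψ
  sat s   w (∼ φ)   = sat (flipS s) w φ
  sat s   w (φ □→ ψ) =
    ∀ v → w ≤ v → ∀ u → R v (λ x → sat pos x φ) (λ x → sat neg x φ) u → sat s u ψ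
  sat s   w (φ ◇→ ψ) =
    Σ W (λ u → R w (λ x → sat pos x φ) (λ x → sat neg x φ) u × sat s u ψ)

CnCKR : Fm → Set₁
CnCKR φ = (M : CFSModel) → Reflexive M → (w : CFSModel.W M) → sat M pos w φ

{-# OPTIONS --safe #-}
-- In a reflexive model every R_‖φ‖-successor is a φ-world, so validity of φ ⇒ ψ gives
-- validity of φ □→ ψ. Conversely, given a φ-world v of a reflexive model, adjoin a fresh
-- isolated root whose only R-successors are the worlds above v lying, together with their
-- whole up-set, in the antecedent; the old worlds keep their truth values, so φ □→ ψ at
-- the root yields ψ at v. A one-world model with empty R refutes every φ ◇→ ψ.
module Submission where

open import Defs
open import Data.Empty using (⊥)
open import Data.Product using (Σ; _×_; _,_; proj₁; swap)
open import Data.Sum using (inj₁; inj₂)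
open import Data.Unit using (⊤; tt)
open import Function using (_∘_; id)
open import Relation.Nullary using (¬_)

⇔ₚ-sym : {W : Set} {X Y : W → Set} → X ⇔ₚ Y → Y ⇔ₚ X
⇔ₚ-sym X⇔Y w = swap (X⇔Y w)

module _ (M : CFSModel) where
  open CFSModel M

  successor-mono : ∀ {X Y} {P : W → Set} → (∀ {u u'} → u ≤ u' → P u → P u') →
                   ∀ {w w'} → w ≤ w' →
                   Σ W (λ u → R w X Y u × P u) → Σ W (λ u → R w' X Y u × P u)
  successor-mono P-mono w≤w' (u , wRu , Pu) with c1 _ _ w≤w' wRu
  ... | u' , w'Ru' , u≤u' = u' , w'Ru' , P-mono u≤u' Pu

  sat-mono : ∀ s φ {w w'} → w ≤ w' → sat M s w φ → sat M s w' φ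
  sat-mono pos (var p) w≤w' = V⁺-up p w≤w'
  sat-mono neg (var p) w≤w' = V⁻-up p w≤w'
  sat-mono pos (φ ∧ ψ) w≤w' (w⊨φ , w⊨ψ) = sat-mono pos φ w≤w' w⊨φ , sat-mono pos ψ w≤w' w⊨ψ
  sat-mono neg (φ ∧ ψ) w≤w' (inj₁ w⊨φ)  = inj₁ (sat-mono neg φ w≤w' w⊨φ)
  sat-mono neg (φ ∧ ψ) w≤w' (inj₂ w⊨ψ)  = inj₂ (sat-mono neg ψ w≤w' w⊨ψ)
  sat-mono pos (φ ∨ ψ) w≤w' (inj₁ w⊨φ)  = inj₁ (sat-mono pos φ w≤w' w⊨φ)
  sat-mono pos (φ ∨ ψ) w≤w' (inj₂ w⊨ψ)  = inj₂ (sat-mono pos ψ w≤w' w⊨ψ)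
  sat-mono neg (φ ∨ ψ) w≤w' (w⊨φ , w⊨ψ) = sat-mono neg φ w≤w' w⊨φ , sat-mono neg ψ w≤w' w⊨ψ
  sat-mono pos (φ ⇒ ψ) w≤w' h = λ v → h v ∘ ≤-trans w≤w'
  sat-mono neg (φ ⇒ ψ) w≤w' h = λ v → h v ∘ ≤-trans w≤w'
  sat-mono pos (∼ φ) = sat-mono neg φ
  sat-mono neg (∼ φ) = sat-mono pos φ
  sat-mono pos (φ □→ ψ) w≤w' h = λ v → h v ∘ ≤-trans w≤w'
  sat-mono neg (φ □→ ψ) w≤w' h = λ v → h v ∘ ≤-trans w≤w'
  sat-mono pos (φ ◇→ ψ) = successor-mono (sat-mono pos ψ)
  sat-mono neg (φ ◇→ ψ) = successor-mono (sat-mono neg ψ)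

module AdjoinRoot (M : CFSModel) (v₀ : CFSModel.W M) where
  open CFSModel M

  data W⁺ : Set where
    old  : W → W⁺
    root : W⁺

  data _≤⁺_ : W⁺ → W⁺ → Set where
    old≤old   : ∀ {a b} → a ≤ b → old a ≤⁺ old b
    root≤root : root ≤⁺ root

  ≤⁺-refl : ∀ {w} → w ≤⁺ w
  ≤⁺-refl {old a} = old≤old ≤-refl
  ≤⁺-refl {root}  = root≤root

  ≤⁺-trans : ∀ {u v w} → u ≤⁺ v → v ≤⁺ w → u ≤⁺ w
  ≤⁺-trans (old≤old a≤b) (old≤old b≤c) = old≤old (≤-trans a≤b b≤c)
  ≤⁺-trans root≤root     root≤root     = root≤root

  -- Asking for the whole up-set of b to lie in X (not just b) is what makes R⁺ closed
  -- under (c2) while still reflexive, for arbitrary X.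
  R⁺ : W⁺ → (W⁺ → Set) → (W⁺ → Set) → W⁺ → Set
  R⁺ _       _ _ root    = ⊥
  R⁺ (old a) X Y (old b) = R a (X ∘ old) (Y ∘ old) b
  R⁺ root    X _ (old b) = v₀ ≤ b × (∀ {b'} → b ≤ b' → X (old b'))

  R⁺-ext : ∀ {X X' Y Y' w v} → X ⇔ₚ X' → Y ⇔ₚ Y' → R⁺ w X Y v → R⁺ w X' Y' v
  R⁺-ext {w = old a} {old b} X⇔X' Y⇔Y' aRb = R-ext (X⇔X' ∘ old) (Y⇔Y' ∘ old) aRb
  R⁺-ext {w = root}  {old b} X⇔X' _ (v₀≤b , X↑b) = v₀≤b , proj₁ (X⇔X' _) ∘ X↑b

  V-lift : (Atom → W → Set) → Atom → W⁺ → Set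
  V-lift V p (old a) = V p a
  V-lift V p root    = ⊥

  V-lift-up : ∀ {V} → (∀ p {w w'} → w ≤ w' → V p w → V p w') →
              ∀ p {w w'} → w ≤⁺ w' → V-lift V p w → V-lift V p w'
  V-lift-up V-up p (old≤old a≤b) = V-up p a≤b
  V-lift-up V-up p root≤root     = λ ()

  c1⁺ : ∀ X Y {w w' v} → w ≤⁺ w' → R⁺ w X Y v → Σ W⁺ (λ v' → R⁺ w' X Y v' × v ≤⁺ v')
  c1⁺ X Y {v = old b} (old≤old a≤a') aRb with c1 _ _ a≤a' aRb
  ... | b' , a'Rb' , b≤b' = old b' , a'Rb' , old≤old b≤b'
  c1⁺ X Y {v = old b} root≤root rootRb = old b , rootRb , ≤⁺-refl

  c2⁺ : ∀ X Y {w v v'} → R⁺ w X Y v → v ≤⁺ v' → Σ W⁺ (λ w' → w ≤⁺ w' × R⁺ w' X Y v')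
  c2⁺ X Y {old a} aRb (old≤old b≤b') with c2 _ _ aRb b≤b'
  ... | a' , a≤a' , a'Rb' = old a' , old≤old a≤a' , a'Rb'
  c2⁺ X Y {root} (v₀≤b , X↑b) (old≤old b≤b') =
    root , root≤root , ≤-trans v₀≤b b≤b' , X↑b ∘ ≤-trans b≤b'

  M⁺ : CFSModel
  M⁺ = record
    { W = W⁺ ; w₀ = root ; _≤_ = _≤⁺_ ; ≤-refl = ≤⁺-refl ; ≤-trans = ≤⁺-trans
    ; R = R⁺ ; R-ext = λ {w = w} {v = v} → R⁺-ext {w = w} {v = v}
    ; V⁺ = V-lift V⁺ ; V⁻ = V-lift V⁻
    ; V⁺-up = V-lift-up V⁺-up ; V⁻-up = V-lift-up V⁻-up
    ; c1 = c1⁺ ; c2 = c2⁺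
    }

  reflexive : Reflexive M → Reflexive M⁺
  reflexive M-refl {old a} X Y {old b} aRb       = M-refl (X ∘ old) (Y ∘ old) aRb
  reflexive M-refl {root}  X Y {old b} (_ , X↑b) = X↑b ≤-refl

  mutual
    sat-old→sat : ∀ s φ {a} → sat M⁺ s (old a) φ → sat M s a φ
    sat-old→sat pos (var p) = id
    sat-old→sat neg (var p) = id
    sat-old→sat pos (φ ∧ ψ) (a⊨φ , a⊨ψ) = sat-old→sat pos φ a⊨φ , sat-old→sat pos ψ a⊨ψ
    sat-old→sat neg (φ ∧ ψ) (inj₁ a⊨φ)  = inj₁ (sat-old→sat neg φ a⊨φ)
    sat-old→sat neg (φ ∧ ψ) (inj₂ a⊨ψ)  = inj₂ (sat-old→sat neg ψ a⊨ψ)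
    sat-old→sat pos (φ ∨ ψ) (inj₁ a⊨φ)  = inj₁ (sat-old→sat pos φ a⊨φ)
    sat-old→sat pos (φ ∨ ψ) (inj₂ a⊨ψ)  = inj₂ (sat-old→sat pos ψ a⊨ψ)
    sat-old→sat neg (φ ∨ ψ) (a⊨φ , a⊨ψ) = sat-old→sat neg φ a⊨φ , sat-old→sat neg ψ a⊨ψ
    sat-old→sat pos (φ ⇒ ψ) h v a≤v v⊨φ =
      sat-old→sat pos ψ (h (old v) (old≤old a≤v) (sat→sat-old pos φ v⊨φ))
    sat-old→sat neg (φ ⇒ ψ) h v a≤v v⊨φ =
      sat-old→sat neg ψ (h (old v) (old≤old a≤v) (sat→sat-old pos φ v⊨φ))
    sat-old→sat pos (∼ φ) = sat-old→sat neg φ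
    sat-old→sat neg (∼ φ) = sat-old→sat pos φ
    sat-old→sat pos (φ □→ ψ) h v a≤v u vRu =
      sat-old→sat pos ψ (h (old v) (old≤old a≤v) (old u)
        (R-ext (sat⇔sat-old pos φ) (sat⇔sat-old neg φ) vRu))
    sat-old→sat neg (φ □→ ψ) h v a≤v u vRu =
      sat-old→sat neg ψ (h (old v) (old≤old a≤v) (old u)
        (R-ext (sat⇔sat-old pos φ) (sat⇔sat-old neg φ) vRu))
    sat-old→sat pos (φ ◇→ ψ) (old u , aRu , u⊨ψ) =
      u , R-ext (sat-old⇔sat pos φ) (sat-old⇔sat neg φ) aRu , sat-old→sat pos ψ u⊨ψ
    sat-old→sat neg (φ ◇→ ψ) (old u , aRu , u⊨ψ) =
      u , R-ext (sat-old⇔sat pos φ) (sat-old⇔sat neg φ) aRu , sat-old→sat neg ψ u⊨ψ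

    sat→sat-old : ∀ s φ {a} → sat M s a φ → sat M⁺ s (old a) φ
    sat→sat-old pos (var p) = id
    sat→sat-old neg (var p) = id
    sat→sat-old pos (φ ∧ ψ) (a⊨φ , a⊨ψ) = sat→sat-old pos φ a⊨φ , sat→sat-old pos ψ a⊨ψ
    sat→sat-old neg (φ ∧ ψ) (inj₁ a⊨φ)  = inj₁ (sat→sat-old neg φ a⊨φ)
    sat→sat-old neg (φ ∧ ψ) (inj₂ a⊨ψ)  = inj₂ (sat→sat-old neg ψ a⊨ψ)
    sat→sat-old pos (φ ∨ ψ) (inj₁ a⊨φ)  = inj₁ (sat→sat-old pos φ a⊨φ)
    sat→sat-old pos (φ ∨ ψ) (inj₂ a⊨ψ)  = inj₂ (sat→sat-old pos ψ a⊨ψ)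
    sat→sat-old neg (φ ∨ ψ) (a⊨φ , a⊨ψ) = sat→sat-old neg φ a⊨φ , sat→sat-old neg ψ a⊨ψ
    sat→sat-old pos (φ ⇒ ψ) h = λ { _ (old≤old a≤v) v⊨φ →
      sat→sat-old pos ψ (h _ a≤v (sat-old→sat pos φ v⊨φ)) }
    sat→sat-old neg (φ ⇒ ψ) h = λ { _ (old≤old a≤v) v⊨φ →
      sat→sat-old neg ψ (h _ a≤v (sat-old→sat pos φ v⊨φ)) }
    sat→sat-old pos (∼ φ) = sat→sat-old neg φ
    sat→sat-old neg (∼ φ) = sat→sat-old pos φ
    sat→sat-old pos (φ □→ ψ) h = λ { _ (old≤old a≤v) (old u) vRu →
      sat→sat-old pos ψ (h _ a≤v u
        (R-ext (sat-old⇔sat pos φ) (sat-old⇔sat neg φ) vRu)) }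
    sat→sat-old neg (φ □→ ψ) h = λ { _ (old≤old a≤v) (old u) vRu →
      sat→sat-old neg ψ (h _ a≤v u
        (R-ext (sat-old⇔sat pos φ) (sat-old⇔sat neg φ) vRu)) }
    sat→sat-old pos (φ ◇→ ψ) (u , aRu , u⊨ψ) =
      old u , R-ext (sat⇔sat-old pos φ) (sat⇔sat-old neg φ) aRu , sat→sat-old pos ψ u⊨ψ
    sat→sat-old neg (φ ◇→ ψ) (u , aRu , u⊨ψ) =
      old u , R-ext (sat⇔sat-old pos φ) (sat⇔sat-old neg φ) aRu , sat→sat-old neg ψ u⊨ψ

    sat-old⇔sat : ∀ s φ → (λ a → sat M⁺ s (old a) φ) ⇔ₚ (λ a → sat M s a φ)
    sat-old⇔sat s φ _ = sat-old→sat s φ , sat→sat-old s φ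

    sat⇔sat-old : ∀ s φ → (λ a → sat M s a φ) ⇔ₚ (λ a → sat M⁺ s (old a) φ)
    sat⇔sat-old s φ = ⇔ₚ-sym (sat-old⇔sat s φ)

  □→-at-root : ∀ φ ψ → sat M⁺ pos root (φ □→ ψ) → sat M pos v₀ φ → sat M pos v₀ ψ
  □→-at-root φ ψ root⊨φ□→ψ v₀⊨φ =
    sat-old→sat pos ψ (root⊨φ□→ψ root root≤root (old v₀) (≤-refl , v₀↑⊨φ))
    where
    v₀↑⊨φ : ∀ {b} → v₀ ≤ b → sat M⁺ pos (old b) φ
    v₀↑⊨φ v₀≤b = sat→sat-old pos φ (sat-mono M pos φ v₀≤b v₀⊨φ)

□→-valid→⇒-valid : ∀ φ ψ → CnCKR (φ □→ ψ) → CnCKR (φ ⇒ ψ)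
□→-valid→⇒-valid φ ψ ⊨φ□→ψ M M-refl _ v _ =
  □→-at-root φ ψ (⊨φ□→ψ M⁺ (reflexive M-refl) root)
  where open AdjoinRoot M v

⇒-valid→□→-valid : ∀ φ ψ → CnCKR (φ ⇒ ψ) → CnCKR (φ □→ ψ)
⇒-valid→□→-valid φ ψ ⊨φ⇒ψ M M-refl _ _ _ u vRu =
  ⊨φ⇒ψ M M-refl u u (CFSModel.≤-refl M) (M-refl _ _ vRu)

isolatedPoint : CFSModel
isolatedPoint = record
  { W = ⊤ ; w₀ = tt ; _≤_ = λ _ _ → ⊤ ; ≤-refl = tt ; ≤-trans = λ _ _ → tt
  ; R = λ _ _ _ _ → ⊥ ; R-ext = λ _ _ ()
  ; V⁺ = λ _ _ → ⊥ ; V⁻ = λ _ _ → ⊥ ; V⁺-up = λ _ _ () ; V⁻-up = λ _ _ ()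
  ; c1 = λ _ _ _ () ; c2 = λ _ _ ()
  }

◇→-invalid : ∀ φ ψ → ¬ CnCKR (φ ◇→ ψ)
◇→-invalid φ ψ ⊨φ◇→ψ with ⊨φ◇→ψ isolatedPoint (λ _ _ ()) tt
... | _ , () , _

lemma6p2 : (φ ψ : Fm) →
    ((CnCKR (φ □→ ψ) → CnCKR (φ ⇒ ψ)) × (CnCKR (φ ⇒ ψ) → CnCKR (φ □→ ψ)))
    × ¬ CnCKR (φ ◇→ ψ)
lemma6p2 φ ψ = (□→-valid→⇒-valid φ ψ , ⇒-valid→□→-valid φ ψ) , ◇→-invalid φ ψ
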